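{- The set of natural numbers $m$ that occur exactly twice in the sequence $(a(n))_{n\ge0}$ (i.e., $|\{n : a(n)=m\}|=2$) is precisely the set of natural numbers not of the form $\lfloor \varphi k+\tfrac12\rfloor$ for any integer $k\ge 0$.
   Context: $\varphi=(1+\sqrt5)/2$. Fibonacci numbers: $F_0=0$, $F_1=1$, $F_n=F_{n-1}+F_{n-2}$. The sequence $(a(n))_{n\geq 0}$ (OEIS A105774) is defined by $a(n)=n$ for $n\le 1$, and $a(n)=F_{j+1}-a(n-F_j)$ if $F_j<n\le F_{j+1}$ with $j\ge 2$. -}

module Defs where

open import Data.Nat using (ℕ; zero; suc; _+_; _*_; _∸_; _^_; _≤_; _<_; _≤?_)
open import Data.Integer as ℤ using (ℤ; +_)
open import Data.Product using (Σ; _×_; _,_; ∃)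
open import Data.Sum using (_⊎_)
open import Relation.Nullary using (yes; no)
open import Relation.Binary.PropositionalEquality using (_≡_)

F : ℕ → ℕ
F zero = 0
F (suc zero) = 1
F (suc (suc n)) = F (suc n) + F n

-- Started at j = 2 with n ≥ 2 this returns the unique
-- j ≥ 2 with F j < n ≤ F (j+1) (fuel n suffices since F (n+1) ≥ n).
findJ : ℕ → ℕ → ℕ → ℕ
findJ zero j n = j
findJ (suc f) j n with n ≤? F (suc j)
... | yes _ = j
... | no  _ = findJ f (suc j) n

-- a-go fuel n computes a(n); fuel ≥ n suffices since n - F j < n.
-- Values are taken in ℤ so that the subtraction F_{j+1} - a(n - F_j) is exact.
a-go : ℕ → ℕ → ℤ
a-go zero n = + n
a-go (suc f) n with n ≤? 1
... | yes _ = + n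
... | no  _ = let j = findJ n 2 n in
              (+ F (suc j)) ℤ.- a-go f (n ∸ F j)

-- The sequence A105774: a(n) = n for n ≤ 1,
-- a(n) = F_{j+1} - a(n - F_j) for F_j < n ≤ F_{j+1}, j ≥ 2.
a : ℕ → ℤ
a n = a-go n n

OccursExactlyTwice : ℕ → Set
OccursExactlyTwice m =
  Σ ℕ λ n₁ → Σ ℕ λ n₂ →
    n₁ < n₂ × a n₁ ≡ + m × a n₂ ≡ + m ×
    (∀ n → a n ≡ + m → n ≡ n₁ ⊎ n ≡ n₂)

-- IsRoundPhi k m  :⇔  m = ⌊ φ k + 1/2 ⌋, i.e. m ≤ φk + 1/2 < m + 1,
-- where φ = (1+√5)/2.  Multiplying by 2:  2m ≤ k + 1 + k√5 < 2m + 2.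
--  * 2m ≤ k + 1 + k√5  ⇔  (2m ∸ (k+1))² ≤ 5k²   (trivial if 2m ≤ k+1)
--  * k + 1 + k√5 < 2m + 2  ⇔  k < 2m + 1  and  5k² < (2m + 1 ∸ k)²
IsRoundPhi : ℕ → ℕ → Set
IsRoundPhi k m =
  ((2 * m ∸ (k + 1)) ^ 2 ≤ 5 * k ^ 2) ×
  (k < 2 * m + 1 × 5 * k ^ 2 < (2 * m + 1 ∸ k) ^ 2)

{-# OPTIONS --safe #-}
-- Write G = F (j + 1) and H = F (j − 1), so that G = F j + H. For j ≥ 4 the recursion
-- a (F j + i) = G − a i (1 ≤ i ≤ H) maps the block (F j, G] into the open interval (F j, G)
-- and never produces the value F j, so the preimages of m ∈ (F j, G) are the preimages of
-- the reflected value G − m < m, shifted by F j.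
--
-- With x = 2m − k, m = ⌊φk + 1/2⌋ means x − 1 ≤ k√5 < x + 1. The Lucas number L = F j + 2H
-- satisfies L² = 5 (F j)² ± 4 (Cassini), so L / F j is a best one-sided approximation of √5,
-- and the reflection (x, k) ↦ (L − x, F j − k) preserves the condition whenever m < G lies
-- outside [H, F j]: a failure would force (x ± 1, k) to be proportional to (L, F j), hence
-- (by coprimality) equal to 0, (L, F j) / 2 or (L, F j), and the middle case pins m to
-- (G ± 1) / 2. So m is of the form ⌊φk + 1/2⌋ iff G − m is, and strong induction on m
-- reduces the theorem to m ≤ 2 and to the Fibonacci numbers F j = ⌊φ F (j − 1) + 1/2⌋,
-- which never occur.
module Submission where

open import Defs
open import Data.Nat using (ℕ)
open import Data.Product using (∃)
open import Function.Bundles using (_⇔_; mk⇔)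
open import Relation.Nullary using (¬_; yes; no)

open import Data.Empty using (⊥; ⊥-elim)
open import Data.Integer using (+_)
import Data.Integer as ℤ
import Data.Integer.Properties as ℤ
open import Data.Nat
open import Data.Nat.Coprimality using (Coprime; coprime-divisor)
open import Data.Nat.Divisibility using (_∣_; divides; ∣m+n∣m⇒∣n; ∣m∣n⇒∣m+n; ∣n⇒∣m*n; m∣m*n; ∣1⇒≡1)
open import Data.Nat.Induction using (<-rec)
open import Data.Nat.Properties
open import Data.Nat.Tactic.RingSolver using (solve-∀)
open import Data.Product using (_×_; _,_; proj₁; proj₂; ∃₂)
open import Data.Sum using (_⊎_; inj₁; inj₂)
import Data.Sum as Sum
open import Data.Unit using (tt)
open import Relation.Binary.PropositionalEquality

m*m≤n*n⇒m≤n : ∀ {m n} → m * m ≤ n * n → m ≤ n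
m*m≤n*n⇒m≤n m²≤n² = ≮⇒≥ (λ n<m → <⇒≱ (*-mono-< n<m n<m) m²≤n²)

m*m<n*n⇒m<n : ∀ {m n} → m * m < n * n → m < n
m*m<n*n⇒m<n m²<n² = ≰⇒> (λ n≤m → <⇒≱ m²<n² (*-mono-≤ n≤m n≤m))

pred-square+4≤square : ∀ {n} → 3 ≤ n → (n ∸ 1) * (n ∸ 1) + 4 ≤ n * n
pred-square+4≤square {1} (s≤s ())
pred-square+4≤square {2} (s≤s (s≤s ()))
pred-square+4≤square {suc (suc (suc n))} _ =
  subst (suc (suc n) * suc (suc n) + 4 ≤_) (expand n) (m≤m+n _ (2 * n + 1))
  where
  expand : ∀ n → suc (suc n) * suc (suc n) + 4 + (2 * n + 1) ≡ suc (suc (suc n)) * suc (suc (suc n))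
  expand = solve-∀

square+4<suc-square : ∀ {n} → 2 ≤ n → n * n + 4 < suc n * suc n
square+4<suc-square {1} (s≤s ())
square+4<suc-square {suc (suc n)} _ =
  subst (suc (suc n) * suc (suc n) + 4 <_) (expand n) (m<m+n _ z<s)
  where
  expand : ∀ n → suc (suc n) * suc (suc n) + 4 + suc (2 * n) ≡ suc (suc (suc n)) * suc (suc (suc n))
  expand = solve-∀

2*n≡n+n : ∀ n → 2 * n ≡ n + n
2*n≡n+n n = cong (_+_ n) (+-identityʳ n)

2m+1<2n : ∀ {m n} → m < n → 2 * m + 1 < 2 * n
2m+1<2n {m} {n} m<n = begin-strict
  2 * m + 1   <⟨ +-monoʳ-< (2 * m) (n<1+n 1) ⟩
  2 * m + 2   ≡⟨ *-distribˡ-+ 2 m 1 ⟨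
  2 * (m + 1) ≡⟨ cong (2 *_) (+-comm m 1) ⟩
  2 * suc m   ≤⟨ *-monoʳ-≤ 2 m<n ⟩
  2 * n       ∎
  where open ≤-Reasoning

≤-≤-+≡+⇒≡ : ∀ {u s v t} → u ≤ s → v ≤ t → u + v ≡ s + t → u ≡ s
≤-≤-+≡+⇒≡ {u} {s} {v} {t} u≤s v≤t sum≡ = ≤-antisym u≤s (+-cancelʳ-≤ t s u (begin
  s + t ≡⟨ sum≡ ⟨
  u + v ≤⟨ +-monoʳ-≤ u v≤t ⟩
  u + t ∎))
  where open ≤-Reasoning

-- Comparison with √5

record Below√5 (u v : ℕ) : Set where
  constructor mkBelow
  field square≤ : u * u ≤ 5 * (v * v)

record Above√5 (u v : ℕ) : Set where
  constructor mkAbove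
  field square> : 5 * (v * v) < u * u

below-or-above√5 : ∀ u v → Below√5 u v ⊎ Above√5 u v
below-or-above√5 u v = Sum.map mkBelow mkAbove (≤-<-connex (u * u) (5 * (v * v)))

¬above√5-zero : ∀ {v} → ¬ Above√5 0 v
¬above√5-zero (mkAbove ())

¬below√5-zero : ∀ {u} → ¬ Below√5 (suc u) 0
¬below√5-zero (mkBelow ())

below-above⇒< : ∀ {u v s t} → Below√5 u v → Above√5 s t → v ≤ t → u < s
below-above⇒< {u} {v} {s} {t} (mkBelow u≤v√5) (mkAbove t√5<s) v≤t = m*m<n*n⇒m<n (begin-strict
  u * u       ≤⟨ u≤v√5 ⟩
  5 * (v * v) ≤⟨ *-monoʳ-≤ 5 (*-mono-≤ v≤t v≤t) ⟩
  5 * (t * t) <⟨ t√5<s ⟩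
  s * s       ∎)
  where open ≤-Reasoning

private
  square-of-product : ∀ u s → (u * s) * (u * s) ≡ (u * u) * (s * s)
  square-of-product = solve-∀

  square-of-5-product : ∀ v t → (5 * (v * t)) * (5 * (v * t)) ≡ (5 * (v * v)) * (5 * (t * t))
  square-of-5-product = solve-∀

  square-of-sum : ∀ u s → (u + s) * (u + s) ≡ u * u + s * s + 2 * (u * s)
  square-of-sum = solve-∀

  five-square-of-sum : ∀ v t → 5 * ((v + t) * (v + t)) ≡ 5 * (v * v) + 5 * (t * t) + 2 * (5 * (v * t))
  five-square-of-sum = solve-∀

below√5-* : ∀ {u v s t} → Below√5 u v → Below√5 s t → u * s ≤ 5 * (v * t)
below√5-* {u} {v} {s} {t} (mkBelow hu) (mkBelow hs) = m*m≤n*n⇒m≤n (begin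
  (u * s) * (u * s)                 ≡⟨ square-of-product u s ⟩
  (u * u) * (s * s)                 ≤⟨ *-mono-≤ hu hs ⟩
  (5 * (v * v)) * (5 * (t * t))     ≡⟨ square-of-5-product v t ⟨
  (5 * (v * t)) * (5 * (v * t))     ∎)
  where open ≤-Reasoning

above√5-* : ∀ {u v s t} → Above√5 u v → Above√5 s t → 5 * (v * t) ≤ u * s
above√5-* {u} {v} {s} {t} (mkAbove hu) (mkAbove hs) = m*m≤n*n⇒m≤n (begin
  (5 * (v * t)) * (5 * (v * t))     ≡⟨ square-of-5-product v t ⟩
  (5 * (v * v)) * (5 * (t * t))     ≤⟨ *-mono-≤ (<⇒≤ hu) (<⇒≤ hs) ⟩
  (u * u) * (s * s)                 ≡⟨ square-of-product u s ⟨
  (u * s) * (u * s)                 ∎)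
  where open ≤-Reasoning

below√5-+ : ∀ {u v s t} → Below√5 u v → Below√5 s t → Below√5 (u + s) (v + t)
below√5-+ {u} {v} {s} {t} below₁@(mkBelow hu) below₂@(mkBelow hs) = mkBelow (begin
  (u + s) * (u + s)                             ≡⟨ square-of-sum u s ⟩
  u * u + s * s + 2 * (u * s)                   ≤⟨ +-mono-≤ (+-mono-≤ hu hs) (*-monoʳ-≤ 2 (below√5-* below₁ below₂)) ⟩
  5 * (v * v) + 5 * (t * t) + 2 * (5 * (v * t)) ≡⟨ five-square-of-sum v t ⟨
  5 * ((v + t) * (v + t))                       ∎)
  where open ≤-Reasoning

above√5-+ : ∀ {u v s t} → Above√5 u v → Above√5 s t → Above√5 (u + s) (v + t)
above√5-+ {u} {v} {s} {t} above₁@(mkAbove hu) above₂@(mkAbove hs) = mkAbove (begin-strict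
  5 * ((v + t) * (v + t))                       ≡⟨ five-square-of-sum v t ⟩
  5 * (v * v) + 5 * (t * t) + 2 * (5 * (v * t)) <⟨ +-mono-<-≤ (+-mono-< hu hs) (*-monoʳ-≤ 2 (above√5-* above₁ above₂)) ⟩
  u * u + s * s + 2 * (u * s)                   ≡⟨ square-of-sum u s ⟨
  (u + s) * (u + s)                             ∎)
  where open ≤-Reasoning

best-approx√5-above : ∀ {f l c d} → l * l ≡ 5 * (f * f) + 4 → Above√5 c d → d ≤ f → d * l ≤ f * c
best-approx√5-above {f} {l} {c} {d} pell above@(mkAbove 5d²<c²) d≤f = s≤s⁻¹ (m*m<n*n⇒m<n (begin-strict
  (d * l) * (d * l)                               ≡⟨ square-* d l ⟩
  (d * d) * (l * l)                               ≡⟨ cong ((d * d) *_) pell ⟩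
  (d * d) * (5 * (f * f) + 4)                     ≡⟨ expand d f ⟩
  (5 * (d * d)) * (f * f) + (2 * d) * (2 * d)     ≤⟨ +-monoʳ-≤ _ (*-mono-≤ (*-monoʳ-≤ 2 d≤f) (<⇒≤ 2d<c)) ⟩
  (5 * (d * d)) * (f * f) + (2 * f) * c           <⟨ n<1+n _ ⟩
  suc ((5 * (d * d)) * (f * f) + (2 * f) * c)     ≤⟨ s≤s (+-monoˡ-≤ _ (*-monoˡ-≤ (f * f) (<⇒≤ 5d²<c²))) ⟩
  suc ((c * c) * (f * f) + (2 * f) * c)           ≡⟨ square-suc c f ⟩
  suc (f * c) * suc (f * c)                       ∎))
  where
  open ≤-Reasoning
  square-* : ∀ d l → (d * l) * (d * l) ≡ (d * d) * (l * l)
  square-* = solve-∀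
  expand : ∀ d f → (d * d) * (5 * (f * f) + 4) ≡ (5 * (d * d)) * (f * f) + (2 * d) * (2 * d)
  expand = solve-∀
  square-suc : ∀ c f → suc ((c * c) * (f * f) + (2 * f) * c) ≡ suc (f * c) * suc (f * c)
  square-suc = solve-∀
  square-2* : ∀ d → (2 * d) * (2 * d) ≡ 4 * (d * d)
  square-2* = solve-∀
  2d<c : 2 * d < c
  2d<c = below-above⇒< (mkBelow (≤-trans (≤-reflexive (square-2* d)) (*-monoˡ-≤ (d * d) (n≤1+n 4)))) above ≤-refl

best-approx√5-below : ∀ {f l c d} → l * l + 4 ≡ 5 * (f * f) → Below√5 c d → 2 * d ≤ l → c * f ≤ d * l
best-approx√5-below {f} {l} {c} {d} pell (mkBelow c²≤5d²) 2d≤l = s≤s⁻¹ (m*m<n*n⇒m<n (begin-strict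
  (c * f) * (c * f)                               ≡⟨ square-* c f ⟩
  (c * c) * (f * f)                               ≤⟨ *-monoˡ-≤ (f * f) c²≤5d² ⟩
  (5 * (d * d)) * (f * f)                         ≡⟨ *-shuffle d f ⟩
  (d * d) * (5 * (f * f))                         ≡⟨ cong ((d * d) *_) pell ⟨
  (d * d) * (l * l + 4)                           ≡⟨ expand d l ⟩
  (d * l) * (d * l) + (2 * d) * (2 * d)           ≤⟨ +-monoʳ-≤ _ (*-monoʳ-≤ (2 * d) 2d≤l) ⟩
  (d * l) * (d * l) + (2 * d) * l                 <⟨ n<1+n _ ⟩
  suc ((d * l) * (d * l) + (2 * d) * l)           ≡⟨ square-suc d l ⟩
  suc (d * l) * suc (d * l)                       ∎))
  where
  open ≤-Reasoning
  square-* : ∀ c f → (c * f) * (c * f) ≡ (c * c) * (f * f)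
  square-* = solve-∀
  *-shuffle : ∀ d f → (5 * (d * d)) * (f * f) ≡ (d * d) * (5 * (f * f))
  *-shuffle = solve-∀
  expand : ∀ d l → (d * d) * (l * l + 4) ≡ (d * l) * (d * l) + (2 * d) * (2 * d)
  expand = solve-∀
  square-suc : ∀ d l → suc ((d * l) * (d * l) + (2 * d) * l) ≡ suc (d * l) * suc (d * l)
  square-suc = solve-∀

-- Round multiples of φ

record Approx√5 (x k : ℕ) : Set where
  constructor mkApprox
  field
    lower : Below√5 (x ∸ 1) k
    upper : Above√5 (suc x) k

approx√5-below-suc : ∀ {x k} → Approx√5 x k → Below√5 (suc x) (suc k)
approx√5-below-suc {zero}   {k} _ = mkBelow (s≤s z≤n)
approx√5-below-suc {suc x₀} {k} (mkApprox lower _) =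
  subst₂ Below√5 (+-comm x₀ 2) (+-comm k 1) (below√5-+ lower (mkBelow (s≤s (s≤s (s≤s (s≤s z≤n))))))

approx√5-strictMono : ∀ {x k y j} → Approx√5 x k → Approx√5 y j → k < j → x < y
approx√5-strictMono approx-x approx-y k<j =
  s≤s⁻¹ (below-above⇒< (approx√5-below-suc approx-x) (Approx√5.upper approx-y) k<j)

private
  m^2≡n*n : ∀ {m n} → m ≡ n → m ^ 2 ≡ n * n
  m^2≡n*n {m} refl = cong (m *_) (*-identityʳ m)

  [x+k]∸[k+1]≡x∸1 : ∀ x k → x + k ∸ (k + 1) ≡ x ∸ 1
  [x+k]∸[k+1]≡x∸1 x k = trans (sym (∸-+-assoc (x + k) k 1)) (cong (_∸ 1) (m+n∸n≡m x k))

  [x+k+1]∸k≡1+x : ∀ x k → x + k + 1 ∸ k ≡ suc x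
  [x+k+1]∸k≡1+x x k = trans (+-∸-comm 1 (m≤n+m k x)) (trans (cong (_+ 1) (m+n∸n≡m x k)) (+-comm x 1))

  5k^2≡5k*k : ∀ k → 5 * k ^ 2 ≡ 5 * (k * k)
  5k^2≡5k*k k = cong (5 *_) (m^2≡n*n {k} refl)

-- IsRoundPhi k m unfolds to RoundPhiAt k (2 * m); with x = 2m − k it says Approx√5 x k.
RoundPhiAt : ℕ → ℕ → Set
RoundPhiAt k t = (t ∸ (k + 1)) ^ 2 ≤ 5 * k ^ 2 × k < t + 1 × 5 * k ^ 2 < (t + 1 ∸ k) ^ 2

approx√5⇒isRoundPhi : ∀ {x k m} → x + k ≡ 2 * m → Approx√5 x k → IsRoundPhi k m
approx√5⇒isRoundPhi {x} {k} x+k≡2m (mkApprox (mkBelow lower) (mkAbove upper)) =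
  subst (RoundPhiAt k) x+k≡2m
    ( subst₂ _≤_ (sym (m^2≡n*n ([x+k]∸[k+1]≡x∸1 x k))) (sym (5k^2≡5k*k k)) lower
    , subst (k <_) (+-comm 1 (x + k)) (s≤s (m≤n+m k x))
    , subst₂ _<_ (sym (5k^2≡5k*k k)) (sym (m^2≡n*n ([x+k+1]∸k≡1+x x k))) upper )

isRoundPhi⇒approx√5 : ∀ {k m} → IsRoundPhi k m → ∃ λ x → x + k ≡ 2 * m × Approx√5 x k
isRoundPhi⇒approx√5 {k} {m} (lower , k<2m+1 , upper) = 2 * m ∸ k , m∸n+n≡m k≤2m , mkApprox
  (mkBelow (subst₂ _≤_ (m^2≡n*n (sym (∸-+-assoc (2 * m) k 1))) (5k^2≡5k*k k) lower))
  (mkAbove (subst₂ _<_ (5k^2≡5k*k k) (m^2≡n*n (trans (+-∸-comm 1 k≤2m) (+-comm _ 1))) upper))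
  where
  k≤2m : k ≤ 2 * m
  k≤2m = s≤s⁻¹ (subst (k <_) (+-comm (2 * m) 1) k<2m+1)

IsRound : ℕ → Set
IsRound m = ∃ λ k → IsRoundPhi k m

-- Cassini pairs and the reflection

Cassini : ℕ → ℕ → Set
Cassini f h = h * h + f * h ≡ f * f + 1 ⊎ h * h + f * h + 1 ≡ f * f

cassini-step : ∀ {f h} → Cassini f h → Cassini (f + h) f
cassini-step {f} {h} (inj₁ eq) = inj₂ (begin
  f * f + (f + h) * f + 1       ≡⟨ regroup f h ⟩
  f * f + h * f + (f * f + 1)   ≡⟨ cong (_+_ (f * f + h * f)) eq ⟨
  f * f + h * f + (h * h + f * h) ≡⟨ square f h ⟩
  (f + h) * (f + h)             ∎)
  where
  open ≡-Reasoning
  regroup : ∀ f h → f * f + (f + h) * f + 1 ≡ f * f + h * f + (f * f + 1)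
  regroup = solve-∀
  square : ∀ f h → f * f + h * f + (h * h + f * h) ≡ (f + h) * (f + h)
  square = solve-∀
cassini-step {f} {h} (inj₂ eq) = inj₁ (begin
  f * f + (f + h) * f             ≡⟨ regroup f h ⟩
  f * f + h * f + f * f           ≡⟨ cong (_+_ (f * f + h * f)) eq ⟨
  f * f + h * f + (h * h + f * h + 1) ≡⟨ square f h ⟩
  (f + h) * (f + h) + 1           ∎)
  where
  open ≡-Reasoning
  regroup : ∀ f h → f * f + (f + h) * f ≡ f * f + h * f + f * f
  regroup = solve-∀
  square : ∀ f h → f * f + h * f + (h * h + f * h + 1) ≡ (f + h) * (f + h) + 1
  square = solve-∀

cassini⇒coprime : ∀ {f h} → Cassini f h → Coprime f h
cassini⇒coprime {f} {h} cassini {d} (d∣f , d∣h) = ∣1⇒≡1 (d∣1 cassini)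
  where
  d∣h²+fh : d ∣ h * h + f * h
  d∣h²+fh = ∣m∣n⇒∣m+n (∣n⇒∣m*n h d∣h) (∣n⇒∣m*n f d∣h)
  d∣f² : d ∣ f * f
  d∣f² = ∣n⇒∣m*n f d∣f
  d∣1 : Cassini f h → d ∣ 1
  d∣1 (inj₁ eq) = ∣m+n∣m⇒∣n (subst (d ∣_) eq d∣h²+fh) d∣f²
  d∣1 (inj₂ eq) = ∣m+n∣m⇒∣n (subst (d ∣_) (sym eq) d∣f²) d∣h²+fh

cassini⇒pell : ∀ {f h} → Cassini f h →
  (f + h + h) * (f + h + h) ≡ 5 * (f * f) + 4 ⊎ (f + h + h) * (f + h + h) + 4 ≡ 5 * (f * f)
cassini⇒pell {f} {h} (inj₁ eq) = inj₁ (begin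
  (f + h + h) * (f + h + h)               ≡⟨ expand f h ⟩
  f * f + 4 * (h * h + f * h)             ≡⟨ cong (λ t → f * f + 4 * t) eq ⟩
  f * f + 4 * (f * f + 1)                 ≡⟨ collect f ⟩
  5 * (f * f) + 4                         ∎)
  where
  open ≡-Reasoning
  expand : ∀ f h → (f + h + h) * (f + h + h) ≡ f * f + 4 * (h * h + f * h)
  expand = solve-∀
  collect : ∀ f → f * f + 4 * (f * f + 1) ≡ 5 * (f * f) + 4
  collect = solve-∀
cassini⇒pell {f} {h} (inj₂ eq) = inj₂ (begin
  (f + h + h) * (f + h + h) + 4           ≡⟨ expand f h ⟩
  f * f + 4 * (h * h + f * h + 1)         ≡⟨ cong (λ t → f * f + 4 * t) eq ⟩
  f * f + 4 * (f * f)                     ≡⟨ collect f ⟩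
  5 * (f * f)                             ∎)
  where
  open ≡-Reasoning
  expand : ∀ f h → (f + h + h) * (f + h + h) + 4 ≡ f * f + 4 * (h * h + f * h + 1)
  expand = solve-∀
  collect : ∀ f → f * f + 4 * (f * f) ≡ 5 * (f * f)
  collect = solve-∀

-- For f = F (n + 1) and h = F n, g is F (n + 2) and l is the Lucas number F (n + 2) + F n.
module LucasPair {f h : ℕ} (h<f : h < f) (f≤h+h : f ≤ h + h) (cassini : Cassini f h) where

  g l : ℕ
  g = f + h
  l = f + h + h

  instance
    f-nonZero : NonZero f
    f-nonZero = >-nonZero (<-≤-trans z<s h<f)

  l+f≡2g : l + f ≡ 2 * g
  l+f≡2g = lemma f h
    where
    lemma : ∀ f h → f + h + h + f ≡ 2 * (f + h)
    lemma = solve-∀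

  pell : l * l ≡ 5 * (f * f) + 4 ⊎ l * l + 4 ≡ 5 * (f * f)
  pell = cassini⇒pell {f} {h} cassini

  3≤l : 3 ≤ l
  3≤l = +-mono-≤ (+-mono-≤ (≤-trans (s≤s 1≤h) h<f) 1≤h) (z≤n {h})
    where
    1≤h : 1 ≤ h
    1≤h = positive-half (<-≤-trans (<-≤-trans z<s h<f) f≤h+h)
      where
      positive-half : ∀ {n} → 0 < n + n → 0 < n
      positive-half {suc n} _ = z<s

  lucas-approx : Approx√5 l f
  lucas-approx with pell
  ... | inj₁ even = mkApprox
    (mkBelow (+-cancelʳ-≤ 4 _ _ (≤-trans (pred-square+4≤square 3≤l) (≤-reflexive even))))
    (mkAbove (≤-<-trans (m≤m+n _ 4) (subst (_< suc l * suc l) even (*-mono-< (n<1+n l) (n<1+n l)))))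
  ... | inj₂ odd = mkApprox
    (mkBelow (≤-trans (*-mono-≤ (m∸n≤m l 1) (m∸n≤m l 1)) (≤-trans (m≤m+n _ 4) (≤-reflexive odd))))
    (mkAbove (subst (_< suc l * suc l) odd (square+4<suc-square (≤-trans (n≤1+n 2) 3≤l))))

  -- f ∣ 2k because f ∣ kl = fk + 2kh and gcd (f, h) = 1.
  proportional-cases : ∀ {c k} → f * c ≡ k * l → k ≤ f →
    (k ≡ 0 × c ≡ 0) ⊎ (2 * k ≡ f × 2 * c ≡ l) ⊎ (k ≡ f × c ≡ l)
  proportional-cases {c} {k} fc≡kl k≤f with f∣2k
    where
    split : ∀ f h k → k * (f + h + h) ≡ f * k + h * (2 * k)
    split = solve-∀
    f∣2k : f ∣ 2 * k
    f∣2k = coprime-divisor (cassini⇒coprime {f} {h} cassini)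
      (∣m+n∣m⇒∣n (subst (f ∣_) (split f h k) (divides c (trans (sym fc≡kl) (*-comm f c)))) (m∣m*n k))
  ... | divides q 2k≡qf = by-quotient q q≤2 2k≡qf 2c≡ql
    where
    q≤2 : q ≤ 2
    q≤2 = *-cancelʳ-≤ q 2 f (subst (_≤ 2 * f) 2k≡qf (*-monoʳ-≤ 2 k≤f))
    2c≡ql : 2 * c ≡ q * l
    2c≡ql = *-cancelˡ-≡ (2 * c) (q * l) f (begin
      f * (2 * c) ≡⟨ swap₁ f c ⟩
      2 * (f * c) ≡⟨ cong (2 *_) fc≡kl ⟩
      2 * (k * l) ≡⟨ *-assoc 2 k l ⟨
      2 * k * l   ≡⟨ cong (_* l) 2k≡qf ⟩
      q * f * l   ≡⟨ swap₂ q f l ⟩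
      f * (q * l) ∎)
      where
      open ≡-Reasoning
      swap₁ : ∀ f c → f * (2 * c) ≡ 2 * (f * c)
      swap₁ = solve-∀
      swap₂ : ∀ q f l → q * f * l ≡ f * (q * l)
      swap₂ = solve-∀
    by-quotient : ∀ q → q ≤ 2 → 2 * k ≡ q * f → 2 * c ≡ q * l →
      (k ≡ 0 × c ≡ 0) ⊎ (2 * k ≡ f × 2 * c ≡ l) ⊎ (k ≡ f × c ≡ l)
    by-quotient 0 _ 2k≡0 2c≡0 = inj₁ (*-cancelˡ-≡ k 0 2 2k≡0 , *-cancelˡ-≡ c 0 2 2c≡0)
    by-quotient 1 _ 2k≡f 2c≡l = inj₂ (inj₁ (trans 2k≡f (*-identityˡ f) , trans 2c≡l (*-identityˡ l)))
    by-quotient 2 _ 2k≡2f 2c≡2l = inj₂ (inj₂ (*-cancelˡ-≡ k f 2 2k≡2f , *-cancelˡ-≡ c l 2 2c≡2l))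
    by-quotient (suc (suc (suc q))) (s≤s (s≤s ())) _ _

  Outside : ℕ → Set
  Outside m = m < h ⊎ f < m

  outside⇒2m+1≢g : ∀ {m} → Outside m → 2 * m + 1 ≢ g
  outside⇒2m+1≢g {m} (inj₁ m<h) 2m+1≡g = <-irrefl 2m+1≡g (begin-strict
    2 * m + 1 <⟨ 2m+1<2n m<h ⟩
    2 * h     ≡⟨ 2*n≡n+n h ⟩
    h + h     <⟨ +-monoˡ-< h h<f ⟩
    f + h     ∎)
    where open ≤-Reasoning
  outside⇒2m+1≢g {m} (inj₂ f<m) 2m+1≡g = <-irrefl (sym 2m+1≡g) (begin-strict
    f + h     <⟨ +-monoʳ-< f h<f ⟩
    f + f     ≡⟨ 2*n≡n+n f ⟨
    2 * f     ≤⟨ *-monoʳ-≤ 2 (<⇒≤ f<m) ⟩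
    2 * m     <⟨ m<m+n (2 * m) z<s ⟩
    2 * m + 1 ∎)
    where open ≤-Reasoning

  outside⇒2m≢g+1 : ∀ {m} → Outside m → 2 * m ≢ g + 1
  outside⇒2m≢g+1 {m} (inj₁ m<h) 2m≡g+1 = <-irrefl 2m≡g+1 (begin-strict
    2 * m     <⟨ *-monoʳ-< 2 m<h ⟩
    2 * h     ≡⟨ 2*n≡n+n h ⟩
    h + h     ≤⟨ +-monoˡ-≤ h (<⇒≤ h<f) ⟩
    f + h     <⟨ m<m+n (f + h) z<s ⟩
    f + h + 1 ∎)
    where open ≤-Reasoning
  outside⇒2m≢g+1 {m} (inj₂ f<m) 2m≡g+1 = <-irrefl (sym 2m≡g+1) (begin-strict
    f + h + 1 ≡⟨ +-assoc f h 1 ⟩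
    f + (h + 1) ≤⟨ +-monoʳ-≤ f (subst (_≤ f) (+-comm 1 h) h<f) ⟩
    f + f     ≡⟨ 2*n≡n+n f ⟨
    2 * f     <⟨ *-monoʳ-< 2 f<m ⟩
    2 * m     ∎)
    where open ≤-Reasoning

  approx√5-bounds : ∀ {x k m} → x + k ≡ 2 * m → m < g → Approx√5 x k → k ≤ f × x < l
  approx√5-bounds {x} {k} {m} x+k≡2m m<g approx = k≤f , x<l
    where
    x+k<l+f : x + k < l + f
    x+k<l+f = begin-strict
      x + k ≡⟨ x+k≡2m ⟩
      2 * m <⟨ *-monoʳ-< 2 m<g ⟩
      2 * g ≡⟨ l+f≡2g ⟨
      l + f ∎
      where open ≤-Reasoning
    k≤f : k ≤ f
    k≤f = ≮⇒≥ (λ f<k → <-asym x+k<l+f (+-mono-< (approx√5-strictMono lucas-approx approx f<k) f<k))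
    x<l : x < l
    x<l with m≤n⇒m<n∨m≡n k≤f
    ... | inj₁ k<f  = approx√5-strictMono approx lucas-approx k<f
    ... | inj₂ refl = +-cancelʳ-< f x l x+k<l+f

  reflect-upper-even : ∀ {x k x′ k′} → l * l ≡ 5 * (f * f) + 4 →
    k + k′ ≡ f → x + x′ ≡ l → Approx√5 x k → Above√5 (suc x′) k′
  reflect-upper-even {x} {k} {x′} {k′} even k+k′≡f x+x′≡l approx with below-or-above√5 (suc x′) k′
  ... | inj₂ above = above
  ... | inj₁ below = ⊥-elim (<⇒≱ sum<l l≤sum)
    where
    sum<l : suc x′ + (x ∸ 1) < l
    sum<l = below-above⇒< (below√5-+ below (Approx√5.lower approx))
      (mkAbove (subst (5 * (f * f) <_) (sym even) (m<m+n _ z<s))) (≤-reflexive (trans (+-comm k′ k) k+k′≡f))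
    l≤sum : l ≤ suc x′ + (x ∸ 1)
    l≤sum = begin
      l                   ≡⟨ x+x′≡l ⟨
      x + x′              ≤⟨ +-monoˡ-≤ x′ (m≤n+m∸n x 1) ⟩
      suc (x ∸ 1) + x′    ≡⟨ +-comm (suc (x ∸ 1)) x′ ⟩
      x′ + suc (x ∸ 1)    ≡⟨ +-suc x′ (x ∸ 1) ⟩
      suc x′ + (x ∸ 1)    ∎
      where open ≤-Reasoning

  reflect-lower-odd : ∀ {x k x′ k′} → l * l + 4 ≡ 5 * (f * f) →
    k + k′ ≡ f → x + x′ ≡ l → Approx√5 x k → Below√5 (x′ ∸ 1) k′
  reflect-lower-odd {x′ = zero} _ _ _ _ = mkBelow z≤n
  reflect-lower-odd {x} {k} {suc q} {k′} odd k+k′≡f x+x′≡l approx with below-or-above√5 q k′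
  ... | inj₁ below = below
  ... | inj₂ above = ⊥-elim (<-irrefl (trans (sym x+x′≡l) (+-suc x q)) (below-above⇒< lucas-below
      (above√5-+ (Approx√5.upper approx) above) (≤-reflexive (sym k+k′≡f))))
    where
    lucas-below : Below√5 l f
    lucas-below = mkBelow (≤-trans (m≤m+n _ 4) (≤-reflexive odd))

  summand≤f : ∀ {k k′} → k + k′ ≡ f → k ≤ f
  summand≤f {k} {k′} k+k′≡f = subst (k ≤_) k+k′≡f (m≤m+n k k′)

  2k≤l : ∀ {k} → k ≤ f → 2 * k ≤ l
  2k≤l {k} k≤f = begin
    2 * k     ≤⟨ *-monoʳ-≤ 2 k≤f ⟩
    2 * f     ≡⟨ 2*n≡n+n f ⟩
    f + f     ≤⟨ +-monoʳ-≤ f f≤h+h ⟩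
    f + (h + h) ≡⟨ +-assoc f h h ⟨
    l         ∎
    where open ≤-Reasoning

  -- In both lattice arguments below, the two best-approximation inequalities for (x ± 1, k)
  -- and for the reflected point add up to the identity l·f = f·l, so both are equalities.
  reflect-lower-even : ∀ {x k x′ k′ m} → l * l ≡ 5 * (f * f) + 4 → x + k ≡ 2 * m → Outside m →
    k + k′ ≡ f → x + x′ ≡ l → Approx√5 x k → Below√5 (x′ ∸ 1) k′
  reflect-lower-even {x′ = zero} _ _ _ _ _ _ = mkBelow z≤n
  reflect-lower-even {x} {k} {suc q} {k′} {m} even x+k≡2m out k+k′≡f x+x′≡l approx
    with below-or-above√5 q k′
  ... | inj₁ below = below
  ... | inj₂ above = excluded (proportional-cases (sym kl≡f[1+x]) k≤f)
    where
    1+x+q≡l : suc x + q ≡ l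
    1+x+q≡l = trans (sym (+-suc x q)) x+x′≡l
    k≤f : k ≤ f
    k≤f = summand≤f k+k′≡f
    k′≤f : k′ ≤ f
    k′≤f = summand≤f (trans (+-comm k′ k) k+k′≡f)
    kl≡f[1+x] : k * l ≡ f * suc x
    kl≡f[1+x] = ≤-≤-+≡+⇒≡ (best-approx√5-above even (Approx√5.upper approx) k≤f)
      (best-approx√5-above even above k′≤f) (begin
        k * l + k′ * l    ≡⟨ *-distribʳ-+ l k k′ ⟨
        (k + k′) * l      ≡⟨ cong (_* l) k+k′≡f ⟩
        f * l             ≡⟨ cong (f *_) 1+x+q≡l ⟨
        f * (suc x + q)   ≡⟨ *-distribˡ-+ f (suc x) q ⟩
        f * suc x + f * q ∎)
      where open ≡-Reasoning
    regroup : ∀ x k → 2 * (x + k + 1) ≡ 2 * suc x + 2 * k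
    regroup = solve-∀
    excluded : (k ≡ 0 × suc x ≡ 0) ⊎ (2 * k ≡ f × 2 * suc x ≡ l) ⊎ (k ≡ f × suc x ≡ l) →
               Below√5 q k′
    excluded (inj₁ (_ , ()))
    excluded (inj₂ (inj₁ (2k≡f , 2[1+x]≡l))) = ⊥-elim (outside⇒2m+1≢g out (*-cancelˡ-≡ _ _ 2 (begin
      2 * (2 * m + 1)   ≡⟨ cong (λ t → 2 * (t + 1)) x+k≡2m ⟨
      2 * (x + k + 1)   ≡⟨ regroup x k ⟩
      2 * suc x + 2 * k ≡⟨ cong₂ _+_ 2[1+x]≡l 2k≡f ⟩
      l + f             ≡⟨ l+f≡2g ⟩
      2 * g             ∎)))
      where open ≡-Reasoning
    excluded (inj₂ (inj₂ (_ , 1+x≡l))) = ⊥-elim (¬above√5-zero (subst (λ t → Above√5 t k′) q≡0 above))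
      where
      q≡0 : q ≡ 0
      q≡0 = +-cancelˡ-≡ (suc x) q 0 (trans 1+x+q≡l (trans (sym 1+x≡l) (sym (+-identityʳ (suc x)))))

  reflect-upper-odd : ∀ {x k x′ k′ m} → l * l + 4 ≡ 5 * (f * f) → x + k ≡ 2 * m → Outside m →
    k + k′ ≡ f → x + x′ ≡ l → Approx√5 x k → Above√5 (suc x′) k′
  reflect-upper-odd {zero} {k} {x′} {k′} _ _ _ k+k′≡f x′≡l _ with below-or-above√5 (suc x′) k′
  ... | inj₂ above = above
  ... | inj₁ below = ⊥-elim (<-irrefl (cong suc x′≡l)
      (below-above⇒< below (Approx√5.upper lucas-approx) (summand≤f (trans (+-comm k′ k) k+k′≡f))))
  reflect-upper-odd {suc c} {k} {x′} {k′} {m} odd x+k≡2m out k+k′≡f x+x′≡l approx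
    with below-or-above√5 (suc x′) k′
  ... | inj₂ above = above
  ... | inj₁ below = ⊥-elim (excluded (proportional-cases (trans (*-comm f c) cf≡kl) k≤f))
    where
    c+1+x′≡l : c + suc x′ ≡ l
    c+1+x′≡l = trans (+-suc c x′) x+x′≡l
    k≤f : k ≤ f
    k≤f = summand≤f k+k′≡f
    k′≤f : k′ ≤ f
    k′≤f = summand≤f (trans (+-comm k′ k) k+k′≡f)
    cf≡kl : c * f ≡ k * l
    cf≡kl = ≤-≤-+≡+⇒≡ (best-approx√5-below odd (Approx√5.lower approx) (2k≤l k≤f))
      (best-approx√5-below odd below (2k≤l k′≤f)) (begin
        c * f + suc x′ * f ≡⟨ *-distribʳ-+ f c (suc x′) ⟨
        (c + suc x′) * f   ≡⟨ cong (_* f) c+1+x′≡l ⟩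
        l * f              ≡⟨ *-comm l f ⟩
        f * l              ≡⟨ cong (_* l) k+k′≡f ⟨
        (k + k′) * l       ≡⟨ *-distribʳ-+ l k k′ ⟩
        k * l + k′ * l     ∎)
      where open ≡-Reasoning
    regroup : ∀ c k → 2 * (suc c + k) ≡ 2 * c + 2 * k + 2
    regroup = solve-∀
    excluded : (k ≡ 0 × c ≡ 0) ⊎ (2 * k ≡ f × 2 * c ≡ l) ⊎ (k ≡ f × c ≡ l) → ⊥
    excluded (inj₁ (k≡0 , c≡0)) with m*n≡1⇒m≡1 2 m (trans (sym x+k≡2m) (cong₂ (λ c k → suc c + k) c≡0 k≡0))
    ... | ()
    excluded (inj₂ (inj₁ (2k≡f , 2c≡l))) = outside⇒2m≢g+1 out (*-cancelˡ-≡ _ _ 2 (begin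
      2 * (2 * m)       ≡⟨ cong (2 *_) x+k≡2m ⟨
      2 * (suc c + k)   ≡⟨ regroup c k ⟩
      2 * c + 2 * k + 2 ≡⟨ cong₂ (λ u v → u + v + 2) 2c≡l 2k≡f ⟩
      l + f + 2         ≡⟨ cong (_+ 2) l+f≡2g ⟩
      2 * g + 2         ≡⟨ *-distribˡ-+ 2 g 1 ⟨
      2 * (g + 1)       ∎))
      where open ≡-Reasoning
    excluded (inj₂ (inj₂ (k≡f , _))) = ¬below√5-zero (subst (Below√5 (suc x′)) k′≡0 below)
      where
      k′≡0 : k′ ≡ 0
      k′≡0 = +-cancelˡ-≡ k k′ 0 (trans k+k′≡f (trans (sym k≡f) (sym (+-identityʳ k))))

  approx√5-reflect : ∀ {x k m} → x + k ≡ 2 * m → m < g → Outside m → Approx√5 x k →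
            ∃₂ λ x′ k′ → x′ + k′ ≡ 2 * (g ∸ m) × Approx√5 x′ k′
  approx√5-reflect {x} {k} {m} x+k≡2m m<g out approx = l ∸ x , f ∸ k , sum≡ , approx′ pell
    where
    bounds : k ≤ f × x < l
    bounds = approx√5-bounds x+k≡2m m<g approx
    k+k′≡f : k + (f ∸ k) ≡ f
    k+k′≡f = m+[n∸m]≡n (proj₁ bounds)
    x+x′≡l : x + (l ∸ x) ≡ l
    x+x′≡l = m+[n∸m]≡n (<⇒≤ (proj₂ bounds))
    shuffle : ∀ x k x′ k′ → x + k + (x′ + k′) ≡ (x + x′) + (k + k′)
    shuffle = solve-∀
    sum≡ : l ∸ x + (f ∸ k) ≡ 2 * (g ∸ m)
    sum≡ = +-cancelˡ-≡ (2 * m) _ _ (begin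
      2 * m + (l ∸ x + (f ∸ k))     ≡⟨ cong (_+ (l ∸ x + (f ∸ k))) x+k≡2m ⟨
      x + k + (l ∸ x + (f ∸ k))     ≡⟨ shuffle x k (l ∸ x) (f ∸ k) ⟩
      (x + (l ∸ x)) + (k + (f ∸ k)) ≡⟨ cong₂ _+_ x+x′≡l k+k′≡f ⟩
      l + f                         ≡⟨ l+f≡2g ⟩
      2 * g                         ≡⟨ cong (2 *_) (m+[n∸m]≡n (<⇒≤ m<g)) ⟨
      2 * (m + (g ∸ m))             ≡⟨ *-distribˡ-+ 2 m (g ∸ m) ⟩
      2 * m + 2 * (g ∸ m)           ∎)
      where open ≡-Reasoning
    approx′ : l * l ≡ 5 * (f * f) + 4 ⊎ l * l + 4 ≡ 5 * (f * f) → Approx√5 (l ∸ x) (f ∸ k)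
    approx′ (inj₁ even) = mkApprox
      (reflect-lower-even {x′ = l ∸ x} even x+k≡2m out k+k′≡f x+x′≡l approx)
      (reflect-upper-even even k+k′≡f x+x′≡l approx)
    approx′ (inj₂ odd) = mkApprox
      (reflect-lower-odd {x′ = l ∸ x} odd k+k′≡f x+x′≡l approx)
      (reflect-upper-odd odd x+k≡2m out k+k′≡f x+x′≡l approx)

  isRound-reflect : ∀ {m} → m < g → Outside m → IsRound m → IsRound (g ∸ m)
  isRound-reflect {m} m<g out (k , round) with isRoundPhi⇒approx√5 {k} {m} round
  ... | x , x+k≡2m , approx with approx√5-reflect x+k≡2m m<g out approx
  ...   | x′ , k′ , x′+k′≡2[g∸m] , approx′ = k′ , approx√5⇒isRoundPhi {m = g ∸ m} x′+k′≡2[g∸m] approx′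

  isRound-g : IsRound g
  isRound-g = f , approx√5⇒isRoundPhi {m = g} l+f≡2g lucas-approx

-- Fibonacci numbers and their blocks

F-suc-mono : ∀ n → F n ≤ F (suc n)
F-suc-mono zero    = z≤n
F-suc-mono (suc n) = m≤m+n (F (suc n)) (F n)

F-mono-≤ : ∀ {i j} → i ≤ j → F i ≤ F j
F-mono-≤ i≤j = go (≤⇒≤′ i≤j)
  where
  go : ∀ {i j} → i ≤′ j → F i ≤ F j
  go ≤′-refl                  = ≤-refl
  go (≤′-step {n = j} i≤′j) = ≤-trans (go i≤′j) (F-suc-mono j)

F-<-reflect : ∀ {i j} → F i < F j → i < j
F-<-reflect Fi<Fj = ≰⇒> (λ j≤i → <⇒≱ Fi<Fj (F-mono-≤ j≤i))

F-suc-pos : ∀ n → 0 < F (suc n)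
F-suc-pos n = F-mono-≤ {1} {suc n} (s≤s z≤n)

F-<-suc : ∀ j → F (suc (suc j)) < F (suc (suc (suc j)))
F-<-suc j = m<m+n (F (suc (suc j))) (F-suc-pos j)

F-≤-double : ∀ j → F (suc (suc (suc j))) ≤ F (suc (suc j)) + F (suc (suc j))
F-≤-double j = +-monoʳ-≤ (F (suc (suc j))) (F-suc-mono (suc j))

index≤1+F : ∀ n → n ≤ suc (F n)
index≤1+F 0 = z≤n
index≤1+F 1 = s≤s z≤n
index≤1+F 2 = ≤-refl
index≤1+F (suc (suc (suc n))) = s≤s (≤-trans (index≤1+F (suc (suc n)))
  (≤-trans (≤-reflexive (+-comm 1 _)) (+-monoʳ-≤ (F (suc (suc n))) (F-suc-pos n))))

F-cassini : ∀ n → Cassini (F (suc n)) (F n)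
F-cassini zero    = inj₂ refl
F-cassini (suc n) = cassini-step {F (suc n)} {F n} (F-cassini n)

module FibonacciPair (j : ℕ) =
  LucasPair {F (suc (suc (suc j)))} {F (suc (suc j))} (F-<-suc j) (F-≤-double j) (F-cassini (suc (suc j)))

record InBlock (j n : ℕ) : Set where
  constructor inBlock
  field
    F<  : F j < n
    ≤F  : n ≤ F (suc j)

record InOpenBlock (j n : ℕ) : Set where
  constructor inOpenBlock
  field
    F<  : F j < n
    <F  : n < F (suc j)

open⇒inBlock : ∀ {j v} → InOpenBlock j v → InBlock j v
open⇒inBlock (inOpenBlock Fj<v v<F[1+j]) = inBlock Fj<v (<⇒≤ v<F[1+j])

inBlock-unique : ∀ {i j n} → InBlock i n → InBlock j n → i ≡ j
inBlock-unique (inBlock Fi<n n≤F[1+i]) (inBlock Fj<n n≤F[1+j]) =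
  ≤-antisym (s≤s⁻¹ (F-<-reflect (<-≤-trans Fi<n n≤F[1+j])))
            (s≤s⁻¹ (F-<-reflect (<-≤-trans Fj<n n≤F[1+i])))

block-of : ∀ n → ∃ λ j → 2 ≤ j × InBlock j (2 + n)
block-of zero = 2 , ≤-refl , inBlock ≤-refl ≤-refl
block-of (suc n) with block-of n
... | j , 2≤j , inBlock Fj<2+n 2+n≤F[1+j] with m≤n⇒m<n∨m≡n 2+n≤F[1+j]
...   | inj₁ 2+n<F[1+j] = j , 2≤j , inBlock (m<n⇒m<1+n Fj<2+n) 2+n<F[1+j]
...   | inj₂ 2+n≡F[1+j] = suc j , m≤n⇒m≤1+n 2≤j , inBlock (s≤s (≤-reflexive (sym 2+n≡F[1+j]))) 3+n≤F[2+j]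
  where
  open ≤-Reasoning
  3+n≤F[2+j] : 3 + n ≤ F (suc j) + F j
  3+n≤F[2+j] = begin
    3 + n           ≡⟨ cong suc 2+n≡F[1+j] ⟩
    suc (F (suc j)) ≡⟨ +-comm 1 (F (suc j)) ⟩
    F (suc j) + 1   ≤⟨ +-monoʳ-≤ (F (suc j)) (F-mono-≤ {1} {j} (≤-trans (s≤s z≤n) 2≤j)) ⟩
    F (suc j) + F j ∎

block-of-≥4 : ∀ {n} → 4 ≤ n → ∃ λ j → 4 ≤ j × InBlock j n
block-of-≥4 {suc (suc n)} (s≤s (s≤s 2≤n)) with block-of n
... | j , 2≤j , block@(inBlock _ n≤F[1+j]) = j , ≰⇒> j≰3 , block
  where
  j≰3 : ¬ j ≤ 3
  j≰3 j≤3 = <⇒≱ (s≤s (s≤s 2≤n)) (≤-trans n≤F[1+j] (F-mono-≤ (s≤s j≤3)))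

-- The sequence a

findJ-inBlock : ∀ fuel {j₀ j n} → j₀ ≤ j → j < j₀ + fuel → InBlock j n → findJ fuel j₀ n ≡ j
findJ-inBlock zero {j₀} j₀≤j j<j₀+0 _ = ⊥-elim (<⇒≱ (subst (_ <_) (+-identityʳ j₀) j<j₀+0) j₀≤j)
findJ-inBlock (suc fuel) {j₀} {j} {n} j₀≤j j<j₀+1+fuel block@(inBlock Fj<n n≤F[1+j]) with n ≤? F (suc j₀)
... | yes n≤F[1+j₀] = ≤-antisym j₀≤j (s≤s⁻¹ (F-<-reflect (<-≤-trans Fj<n n≤F[1+j₀])))
... | no  n≰F[1+j₀] = findJ-inBlock fuel (≤∧≢⇒< j₀≤j j₀≢j) (subst (j <_) (+-suc j₀ fuel) j<j₀+1+fuel) block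
  where
  j₀≢j : j₀ ≢ j
  j₀≢j refl = n≰F[1+j₀] n≤F[1+j]

findJ-≥ : ∀ fuel j₀ n → j₀ ≤ findJ fuel j₀ n
findJ-≥ zero       j₀ n = ≤-refl
findJ-≥ (suc fuel) j₀ n with n ≤? F (suc j₀)
... | yes _ = ≤-refl
... | no  _ = ≤-trans (n≤1+n j₀) (findJ-≥ fuel (suc j₀) n)

a-go-zero : ∀ fuel → a-go fuel 0 ≡ + 0
a-go-zero zero       = refl
a-go-zero (suc fuel) = refl

a-go-fuel : ∀ fuel₁ fuel₂ n → n ≤ fuel₁ → n ≤ fuel₂ → a-go fuel₁ n ≡ a-go fuel₂ n
a-go-fuel zero fuel₂ zero _ _ = sym (a-go-zero fuel₂)
a-go-fuel (suc fuel₁) zero zero _ _ = a-go-zero (suc fuel₁)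
a-go-fuel (suc fuel₁) (suc fuel₂) n n≤1+fuel₁ n≤1+fuel₂ with n ≤? 1
... | yes _ = refl
... | no  _ = cong (λ t → + F (suc j) ℤ.- t)
                   (a-go-fuel fuel₁ fuel₂ (n ∸ F j) (shrink n≤1+fuel₁) (shrink n≤1+fuel₂))
  where
  j = findJ n 2 n
  shrink : ∀ {fuel} → n ≤ suc fuel → n ∸ F j ≤ fuel
  shrink n≤1+fuel = ≤-trans (∸-monoʳ-≤ n (F-mono-≤ {1} {j} (≤-trans (s≤s z≤n) (findJ-≥ n 2 n))))
                            (∸-monoˡ-≤ 1 n≤1+fuel)

a-unfold : ∀ {j n} → 2 ≤ j → InBlock j n → a n ≡ + F (suc j) ℤ.- a (n ∸ F j)
a-unfold {j} {suc n} 2≤j block@(inBlock Fj<1+n _) with suc n ≤? 1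
... | yes 1+n≤1 = ⊥-elim (<⇒≱ (≤-<-trans (F-mono-≤ {1} {j} (≤-trans (s≤s z≤n) 2≤j)) Fj<1+n) 1+n≤1)
... | no  _ rewrite findJ-inBlock (suc n) 2≤j (m<n⇒m<1+n (s≤s (≤-trans (index≤1+F j) Fj<1+n))) block =
  cong (λ t → + F (suc j) ℤ.- t) (a-go-fuel n (suc n ∸ F j) (suc n ∸ F j) (∸-monoʳ-≤ (suc n) 1≤Fj) ≤-refl)
  where
  1≤Fj : 1 ≤ F j
  1≤Fj = F-mono-≤ {1} {j} (≤-trans (s≤s z≤n) 2≤j)

+m-+n≡+[m∸n] : ∀ {m n} → n ≤ m → + m ℤ.- + n ≡ + (m ∸ n)
+m-+n≡+[m∸n] {m} {n} n≤m = trans (ℤ.m-n≡m⊖n m n) (ℤ.⊖-≥ n≤m)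

a-unfold-ℕ : ∀ {j n w} → 2 ≤ j → InBlock j n → a (n ∸ F j) ≡ + w → w ≤ F (suc j) →
             a n ≡ + (F (suc j) ∸ w)
a-unfold-ℕ {j} 2≤j block aᵢ≡w w≤F[1+j] =
  trans (a-unfold 2≤j block) (trans (cong (λ t → + F (suc j) ℤ.- t) aᵢ≡w) (+m-+n≡+[m∸n] w≤F[1+j]))

offset-bounds : ∀ {j n} → InBlock (suc j) n → 0 < n ∸ F (suc j) × n ∸ F (suc j) ≤ F j
offset-bounds {j} (inBlock F[1+j]<n n≤F[2+j]) =
  m<n⇒0<n∸m F[1+j]<n , ≤-trans (∸-monoˡ-≤ (F (suc j)) n≤F[2+j]) (≤-reflexive (m+n∸m≡n (F (suc j)) (F j)))

reflected-open : ∀ {j w} → 0 < w → w < F j → InOpenBlock (suc j) (F (suc (suc j)) ∸ w)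
reflected-open {j} {w} 0<w w<Fj = inOpenBlock
  (subst (F (suc j) <_) (sym (+-∸-assoc (F (suc j)) (<⇒≤ w<Fj))) (m<m+n (F (suc j)) (m<n⇒0<n∸m w<Fj)))
  (∸-monoʳ-< {o = 0} 0<w (≤-trans (<⇒≤ w<Fj) (m≤n+m (F j) (F (suc j)))))

reflected-below : ∀ {j m} → InOpenBlock (suc j) m → F (suc (suc j)) ∸ m < F j
reflected-below {j} {m} (inOpenBlock F[1+j]<m m<F[2+j]) =
  subst (F (suc (suc j)) ∸ m <_) (m+n∸m≡n (F (suc j)) (F j)) (∸-monoʳ-< F[1+j]<m (<⇒≤ m<F[2+j]))

reflected-< : ∀ {j m} → 0 < j → InOpenBlock j m → F (suc j) ∸ m < m
reflected-< {suc j} _ inOpen = <-trans (reflected-below inOpen) (≤-<-trans (F-suc-mono j) (InOpenBlock.F< inOpen))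

StaysInBlock : ℕ → Set
StaysInBlock n = ∀ {j} → 4 ≤ j → InBlock j n → ∃ λ v → a n ≡ + v × InOpenBlock j v

staysInBlock⇒below-F : ∀ {i q} → StaysInBlock i → 3 ≤ q → 0 < i → i ≤ F q →
                       ∃ λ w → a i ≡ + w × 0 < w × w < F q
staysInBlock⇒below-F {1} _ 3≤q _ _ = 1 , refl , z<s , F-mono-≤ 3≤q
staysInBlock⇒below-F {2} _ 3≤q _ _ = 1 , refl , z<s , F-mono-≤ 3≤q
staysInBlock⇒below-F {3} _ _   _ 3≤Fq = 2 , refl , z<s , 3≤Fq
staysInBlock⇒below-F {suc (suc (suc (suc i)))} {q} stays _ _ i≤Fq
  with block-of-≥4 {suc (suc (suc (suc i)))} (s≤s (s≤s (s≤s (s≤s z≤n))))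
... | j , 4≤j , block@(inBlock Fj<i _) with stays 4≤j block
...   | v , aᵢ≡v , inOpenBlock Fj<v v<F[1+j] =
  v , aᵢ≡v , ≤-<-trans z≤n Fj<v , <-≤-trans v<F[1+j] (F-mono-≤ (F-<-reflect {j} {q} (<-≤-trans Fj<i i≤Fq)))

a-staysInBlock : ∀ n → StaysInBlock n
a-staysInBlock = <-rec StaysInBlock step
  where
  step : ∀ n → (∀ {i} → i < n → StaysInBlock i) → StaysInBlock n
  step n rec {suc j} (s≤s 3≤j) block@(inBlock F[1+j]<n _) with offset-bounds block
  ... | 0<i , i≤Fj with staysInBlock⇒below-F (rec i<n) 3≤j 0<i i≤Fj
    where
    i<n : n ∸ F (suc j) < n
    i<n = ∸-monoʳ-< {o = 0} (F-suc-pos j) (<⇒≤ F[1+j]<n)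
  ...   | w , aᵢ≡w , 0<w , w<Fj =
    F (suc (suc j)) ∸ w ,
    a-unfold-ℕ (s≤s (≤-trans (s≤s z≤n) 3≤j)) block aᵢ≡w (≤-trans (<⇒≤ w<Fj) (m≤n+m (F j) (F (suc j)))) ,
    reflected-open 0<w w<Fj

a-below-F : ∀ {i q} → 3 ≤ q → 0 < i → i ≤ F q → ∃ λ w → a i ≡ + w × 0 < w × w < F q
a-below-F {i} = staysInBlock⇒below-F (a-staysInBlock i)

a-value-inBlock : ∀ {n v} → 4 ≤ n → a n ≡ + v → ∃ λ j → 4 ≤ j × InBlock j n × InOpenBlock j v
a-value-inBlock 4≤n aₙ≡v with block-of-≥4 4≤n
... | j , 4≤j , block with a-staysInBlock _ 4≤j block
...   | v′ , aₙ≡v′ , open′ =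
  j , 4≤j , block , subst (InOpenBlock j) (ℤ.+-injective (trans (sym aₙ≡v′) aₙ≡v)) open′

index≥4 : ∀ n {v} → a n ≡ + v → 3 ≤ v → 4 ≤ n
index≥4 0 refl ()
index≥4 1 refl (s≤s ())
index≥4 2 refl (s≤s ())
index≥4 3 refl (s≤s (s≤s ()))
index≥4 (suc (suc (suc (suc n)))) _ _ = s≤s (s≤s (s≤s (s≤s z≤n)))

value>3 : ∀ {n v} → 4 ≤ n → a n ≡ + v → 3 < v
value>3 4≤n aₙ≡v with a-value-inBlock 4≤n aₙ≡v
... | j , 4≤j , _ , inOpenBlock Fj<v _ = ≤-<-trans (F-mono-≤ 4≤j) Fj<v

index≤F : ∀ {i w q} → a i ≡ + w → w < F q → i ≤ F q
index≤F {0} _ _ = z≤n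
index≤F {1} refl 1<Fq = <⇒≤ 1<Fq
index≤F {2} refl 1<Fq = 1<Fq
index≤F {3} refl 2<Fq = 2<Fq
index≤F {i@(suc (suc (suc (suc _))))} {w} {q} aᵢ≡w w<Fq
  with a-value-inBlock {i} (s≤s (s≤s (s≤s (s≤s z≤n)))) aᵢ≡w
... | j , _ , inBlock _ i≤F[1+j] , inOpenBlock Fj<w _ =
  ≤-trans i≤F[1+j] (F-mono-≤ (F-<-reflect {j} {q} (<-trans Fj<w w<Fq)))

F-not-value : ∀ {j n} → 4 ≤ j → a n ≢ + F j
F-not-value {j} {n} 4≤j aₙ≡Fj with a-value-inBlock (index≥4 n aₙ≡Fj (F-mono-≤ 4≤j)) aₙ≡Fj
... | j′ , _ , _ , inOpenBlock Fj′<Fj Fj<F[1+j′] =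
  <⇒≱ (F-<-reflect {j′} {j} Fj′<Fj) (s≤s⁻¹ (F-<-reflect {j} {suc j′} Fj<F[1+j′]))

preimage-split : ∀ {j m n} → 4 ≤ j → InOpenBlock j m → a n ≡ + m →
                 ∃ λ i → n ≡ F j + i × a i ≡ + (F (suc j) ∸ m)
preimage-split {suc j} {m} {n} (s≤s 3≤j) inOpen@(inOpenBlock F[1+j]<m _) aₙ≡m
  with a-value-inBlock (index≥4 n aₙ≡m 3≤m) aₙ≡m
  where
  3≤m : 3 ≤ m
  3≤m = <⇒≤ (≤-<-trans (F-mono-≤ (s≤s 3≤j)) F[1+j]<m)
... | j′ , _ , block′ , open′ with inBlock-unique (open⇒inBlock open′) (open⇒inBlock inOpen)
... | refl with offset-bounds block′
...   | 0<i , i≤Fj with a-below-F 3≤j 0<i i≤Fj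
...     | w , aᵢ≡w , _ , w<Fj = n ∸ F (suc j) , sym (m+[n∸m]≡n (<⇒≤ (InBlock.F< block′))) ,
  subst (λ t → a (n ∸ F (suc j)) ≡ + t) (sym G∸m≡w) aᵢ≡w
  where
  w≤G : w ≤ F (suc (suc j))
  w≤G = ≤-trans (<⇒≤ w<Fj) (m≤n+m (F j) (F (suc j)))
  aₙ≡G∸w : a n ≡ + (F (suc (suc j)) ∸ w)
  aₙ≡G∸w = a-unfold-ℕ (s≤s (≤-trans (s≤s z≤n) 3≤j)) block′ aᵢ≡w w≤G
  G∸m≡w : F (suc (suc j)) ∸ m ≡ w
  G∸m≡w = trans (cong (F (suc (suc j)) ∸_) (ℤ.+-injective (trans (sym aₙ≡m) aₙ≡G∸w))) (m∸[m∸n]≡n w≤G)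

preimage-join : ∀ {j m i} → 4 ≤ j → InOpenBlock j m → a i ≡ + (F (suc j) ∸ m) → a (F j + i) ≡ + m
preimage-join {suc j} {m} {zero} _ (inOpenBlock _ m<G) aᵢ≡G∸m =
  ⊥-elim (<⇒≱ (m<n⇒0<n∸m m<G) (≤-reflexive (sym (ℤ.+-injective aᵢ≡G∸m))))
preimage-join {suc j} {m} {i@(suc _)} (s≤s 3≤j) inOpen@(inOpenBlock _ m<G) aᵢ≡G∸m =
  trans (a-unfold-ℕ (s≤s (≤-trans (s≤s z≤n) 3≤j)) block aₒ≡G∸m (m∸n≤m G m)) (cong +_ (m∸[m∸n]≡n (<⇒≤ m<G)))
  where
  G = F (suc (suc j))
  block : InBlock (suc j) (F (suc j) + i)
  block = inBlock (m<m+n (F (suc j)) z<s)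
    (+-monoʳ-≤ (F (suc j)) (index≤F {q = j} aᵢ≡G∸m (reflected-below inOpen)))
  aₒ≡G∸m : a (F (suc j) + i ∸ F (suc j)) ≡ + (G ∸ m)
  aₒ≡G∸m = subst (λ t → a t ≡ + (G ∸ m)) (sym (m+n∸m≡n (F (suc j)) i)) aᵢ≡G∸m

a⁻¹-0 : ∀ {n} → a n ≡ + 0 → n ≡ 0
a⁻¹-0 {0} _ = refl
a⁻¹-0 {suc (suc (suc (suc n)))} aₙ≡0 with value>3 (s≤s (s≤s (s≤s (s≤s (z≤n {n}))))) aₙ≡0
... | ()

a⁻¹-1 : ∀ {n} → a n ≡ + 1 → n ≡ 1 ⊎ n ≡ 2
a⁻¹-1 {1} _ = inj₁ refl
a⁻¹-1 {2} _ = inj₂ refl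
a⁻¹-1 {suc (suc (suc (suc n)))} aₙ≡1 with value>3 (s≤s (s≤s (s≤s (s≤s (z≤n {n}))))) aₙ≡1
... | s≤s ()

a⁻¹-2 : ∀ {n} → a n ≡ + 2 → n ≡ 3
a⁻¹-2 {3} _ = refl
a⁻¹-2 {suc (suc (suc (suc n)))} aₙ≡2 with value>3 (s≤s (s≤s (s≤s (s≤s (z≤n {n}))))) aₙ≡2
... | s≤s (s≤s ())

AtMostOnce : ℕ → Set
AtMostOnce m = ∀ {n₁ n₂} → a n₁ ≡ + m → a n₂ ≡ + m → n₁ ≡ n₂

Dichotomy : ℕ → Set
Dichotomy m = (IsRound m → AtMostOnce m) × (¬ IsRound m → OccursExactlyTwice m)

atMostOnce-shift : ∀ {j m} → 4 ≤ j → InOpenBlock j m → AtMostOnce (F (suc j) ∸ m) → AtMostOnce m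
atMostOnce-shift {j} 4≤j inOpen once {n₁} {n₂} aₙ₁≡m aₙ₂≡m
  with preimage-split {n = n₁} 4≤j inOpen aₙ₁≡m | preimage-split {n = n₂} 4≤j inOpen aₙ₂≡m
... | i₁ , refl , aᵢ₁≡m′ | i₂ , refl , aᵢ₂≡m′ = cong (_+_ (F j)) (once aᵢ₁≡m′ aᵢ₂≡m′)

occursTwice-shift : ∀ {j m} → 4 ≤ j → InOpenBlock j m →
                    OccursExactlyTwice (F (suc j) ∸ m) → OccursExactlyTwice m
occursTwice-shift {j} 4≤j inOpen (n₁ , n₂ , n₁<n₂ , aₙ₁≡m′ , aₙ₂≡m′ , only) =
  F j + n₁ , F j + n₂ , +-monoʳ-< (F j) n₁<n₂ ,
  preimage-join 4≤j inOpen aₙ₁≡m′ , preimage-join 4≤j inOpen aₙ₂≡m′ , only′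
  where
  only′ : ∀ n → a n ≡ + _ → n ≡ F j + n₁ ⊎ n ≡ F j + n₂
  only′ n aₙ≡m with preimage-split {n = n} 4≤j inOpen aₙ≡m
  ... | i , refl , aᵢ≡m′ = Sum.map (cong (_+_ (F j))) (cong (_+_ (F j))) (only i aᵢ≡m′)

dichotomy-F : ∀ {j} → 4 ≤ j → Dichotomy (F j)
dichotomy-F {suc (suc (suc (suc j)))} 4≤j@(s≤s (s≤s (s≤s (s≤s _)))) =
  (λ _ {n₁} aₙ₁≡Fj _ → ⊥-elim (F-not-value {n = n₁} 4≤j aₙ₁≡Fj)) ,
  (λ ¬round → ⊥-elim (¬round (FibonacciPair.isRound-g j)))

dichotomy-shift : ∀ {j m} → 4 ≤ j → InOpenBlock j m → Dichotomy (F (suc j) ∸ m) → Dichotomy m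
dichotomy-shift {suc (suc (suc j))} {m} 4≤j@(s≤s (s≤s (s≤s _))) inOpen@(inOpenBlock Fj<m m<g)
                (once′ , twice′) =
  (λ round → atMostOnce-shift 4≤j inOpen (once′ (isRound-reflect m<g (inj₂ Fj<m) round))) ,
  (λ ¬round → occursTwice-shift 4≤j inOpen (twice′ (λ round′ → ¬round (unreflect round′))))
  where
  open FibonacciPair j using (g; isRound-reflect)
  unreflect : IsRound (g ∸ m) → IsRound m
  unreflect round′ = subst IsRound (m∸[m∸n]≡n (<⇒≤ m<g))
    (isRound-reflect (∸-monoʳ-< {o = 0} (≤-<-trans z≤n Fj<m) (<⇒≤ m<g)) (inj₁ (reflected-below inOpen)) round′)

dichotomy-0 : Dichotomy 0
dichotomy-0 = (λ _ aₙ₁≡0 aₙ₂≡0 → trans (a⁻¹-0 aₙ₁≡0) (sym (a⁻¹-0 aₙ₂≡0))) ,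
              (λ ¬round → ⊥-elim (¬round (0 , ≤ᵇ⇒≤ _ _ tt , ≤ᵇ⇒≤ _ _ tt , ≤ᵇ⇒≤ _ _ tt)))

dichotomy-1 : Dichotomy 1
dichotomy-1 = (λ (k , round) → ⊥-elim (¬isRoundPhi-1 k round)) ,
              (λ _ → 1 , 2 , ≤-refl , refl , refl , λ _ → a⁻¹-1)
  where
  ¬isRoundPhi-1 : ∀ k → ¬ IsRoundPhi k 1
  ¬isRoundPhi-1 0 (lower , _)     = ≤⇒≤ᵇ lower
  ¬isRoundPhi-1 1 (_ , _ , upper) = ≤⇒≤ᵇ upper
  ¬isRoundPhi-1 2 (_ , _ , upper) = ≤⇒≤ᵇ upper
  ¬isRoundPhi-1 (suc (suc (suc k))) (_ , s≤s (s≤s (s≤s ())) , _)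

dichotomy-2 : Dichotomy 2
dichotomy-2 = (λ _ aₙ₁≡2 aₙ₂≡2 → trans (a⁻¹-2 aₙ₁≡2) (sym (a⁻¹-2 aₙ₂≡2))) ,
              (λ ¬round → ⊥-elim (¬round (1 , ≤ᵇ⇒≤ _ _ tt , ≤ᵇ⇒≤ _ _ tt , ≤ᵇ⇒≤ _ _ tt)))

dichotomy : ∀ m → Dichotomy m
dichotomy = <-rec Dichotomy step
  where
  step : ∀ m → (∀ {m′} → m′ < m → Dichotomy m′) → Dichotomy m
  step 0 _ = dichotomy-0
  step 1 _ = dichotomy-1
  step 2 _ = dichotomy-2
  step m@(suc (suc (suc _))) rec with block-of-≥4 {suc m} (s≤s (s≤s (s≤s (s≤s z≤n))))
  ... | j , 4≤j , inBlock Fj<1+m 1+m≤F[1+j] with m≤n⇒m<n∨m≡n (s≤s⁻¹ Fj<1+m)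
  ...   | inj₂ Fj≡m = subst Dichotomy Fj≡m (dichotomy-F 4≤j)
  ...   | inj₁ Fj<m = dichotomy-shift 4≤j inOpen (rec (reflected-< (≤-trans (s≤s z≤n) 4≤j) inOpen))
    where
    inOpen : InOpenBlock j m
    inOpen = inOpenBlock Fj<m 1+m≤F[1+j]

proposition3 : (m : ℕ) →
    OccursExactlyTwice m ⇔ (¬ ∃ λ k → IsRoundPhi k m)
proposition3 m = mk⇔ occursTwice⇒¬isRound (proj₂ (dichotomy m))
  where
  occursTwice⇒¬isRound : OccursExactlyTwice m → ¬ IsRound m
  occursTwice⇒¬isRound (_ , _ , n₁<n₂ , aₙ₁≡m , aₙ₂≡m , _) round =
    <-irrefl (proj₁ (dichotomy m) round aₙ₁≡m aₙ₂≡m) n₁<n₂
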